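{- Let $E'$ be a nonempty finite set of $m_{E'}=|E'|$ edges of a simple graph on vertex set $V$, and let $d_u$ denote the degree of $u\in V$ in the graph $(V,E')$. Define $\mathrm{Cost}(E')=\sum_{u\in V} d_u\left(1-\frac{d_u}{m_{E'}}\right)$. Then $m_{E'}-1\le \mathrm{Cost}(E')\le 2m_{E'}-1$. -}

module Defs where

open import Data.Nat using (ℕ; zero; suc; NonZero; _<_; _>_; >-nonZero)
open import Data.Fin using (Fin; toℕ)
open import Data.Fin.Properties using (_≟_)
open import Data.List using (List; []; _∷_; length; allFin; foldr; map)
open import Data.List.Membership.Propositional using (_∈_)
open import Data.List.Relation.Unary.Unique.Propositional using (Unique)
open import Data.Product using (_×_; _,_; proj₁; proj₂)
open import Data.Integer using (+_)
open import Data.Rational using (ℚ; 0ℚ; 1ℚ; _+_; _-_; _*_; _/_)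
open import Relation.Nullary using (yes; no)

-- An edge of a simple graph on vertex set Fin n is stored as an ordered
-- pair (u , v) with toℕ u < toℕ v (canonical representative of {u,v}).
Edge : ℕ → Set
Edge n = Fin n × Fin n

IsSimpleEdgeSet : {n : ℕ} → List (Edge n) → Set
IsSimpleEdgeSet {n} E = (∀ {e} → e ∈ E → toℕ (proj₁ e) < toℕ (proj₂ e)) × Unique E

degree : {n : ℕ} → List (Edge n) → Fin n → ℕ
degree [] u = zero
degree ((a , b) ∷ E) u with a ≟ u | b ≟ u
... | yes _ | _     = suc (degree E u)
... | no _  | yes _ = suc (degree E u)
... | no _  | no _  = degree E u

sumV : (n : ℕ) → (Fin n → ℚ) → ℚ
sumV n f = foldr _+_ 0ℚ (map f (allFin n))

Cost : {n : ℕ} (E : List (Edge n)) → length E > 0 → ℚ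
Cost {n} E m>0 = sumV n (λ u → (+ degree E u / 1) * (1ℚ - _/_ (+ degree E u) (length E) {{>-nonZero m>0}}))

-- With m = |E| and S = Σ_u d_u², the handshake lemma Σ_u d_u = 2m turns the cost into 2m − S/m,
-- so the claim is m ≤ S ≤ m(m + 1). The lower bound follows from d ≤ d² and Σ_u d_u = 2m.
-- For the upper bound, adding an edge ab raises S by 2(d_a + d_b) + 2, where d_a + d_b ≤ |E|
-- because every other edge of a simple graph meets {a, b} in at most one vertex; induction on
-- the edges then gives S ≤ m(m + 1).
module Submission where

open import Defs
open import Data.Nat using (ℕ; _>_) renaming (_*_ to _*ℕ_)
open import Data.List using (List; length)
open import Data.Product using (_×_)
open import Data.Product.Base using (_,_; proj₁; proj₂)
open import Data.Integer using (+_)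
open import Data.Rational using (_≤_; _/_; _-_; 1ℚ)

open import Data.Bool.Base using (if_then_else_)
open import Data.Empty using (⊥-elim)
open import Data.Fin.Base as Fin using (Fin; zero; suc)
open import Data.Fin.Properties as Fin using (<⇒≢)
open import Data.List.Base using ([]; _∷_; foldr; tabulate)
import Data.List.Properties as List
open import Data.List.Relation.Unary.All as All using (All; []; _∷_)
open import Data.List.Relation.Unary.AllPairs using ([]; _∷_)
open import Data.List.Relation.Unary.Unique.Propositional using (Unique)
open import Data.Nat.Base as ℕ using (zero; suc; NonZero; >-nonZero; z≤n)
import Data.Nat.Properties as ℕ
open import Data.Nat.Tactic.RingSolver using (solve-∀)
import Data.Integer.Base as ℤ
import Data.Integer.Properties as ℤ
open import Data.Rational.Base as ℚ using (ℚ; 0ℚ; _+_; _*_; NonNegative; toℚᵘ)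
import Data.Rational.Properties as ℚ
import Data.Rational.Unnormalised.Base as ℚᵘ
import Data.Rational.Unnormalised.Properties as ℚᵘ
open import Data.Rational.Solver renaming (module +-*-Solver to ℚ-Solver)
open import Relation.Nullary using (does; yes; no)
open import Relation.Binary.PropositionalEquality
open import Algebra.Bundles using (Ring)
open import Algebra.Properties.CommutativeSemigroup ℕ.+-commutativeSemigroup
  using () renaming (interchange to +-interchange)

open import Algebra.Properties.Semiring.Sum ℕ.+-*-semiring
  using (sum-syntax; sum-cong-≗; ∑-distrib-+; *-distribˡ-sum; sum-replicate-zero)
import Algebra.Properties.Semiring.Sum (Ring.semiring ℚ.+-*-ring) as ℚΣ

private variable n : ℕ

∑-mono-≤ : {f g : Fin n → ℕ} → (∀ u → f u ℕ.≤ g u) → ∑[ u < n ] f u ℕ.≤ ∑[ u < n ] g u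
∑-mono-≤ {zero}  f≤g = z≤n
∑-mono-≤ {suc n} f≤g = ℕ.+-mono-≤ (f≤g zero) (∑-mono-≤ (λ u → f≤g (suc u)))

δ : Fin n → Fin n → ℕ
δ a u = if does (a Fin.≟ u) then 1 else 0

∑-δ-sift : (a : Fin n) (g : Fin n → ℕ) → ∑[ u < n ] (δ a u ℕ.* g u) ≡ g a
∑-δ-sift {suc n} zero g =
  trans (cong₂ ℕ._+_ (ℕ.*-identityˡ (g zero)) (sum-replicate-zero n)) (ℕ.+-identityʳ (g zero))
∑-δ-sift {suc n} (suc a) g = ∑-δ-sift a (λ u → g (suc u))

incidence : Edge n → Fin n → ℕ
incidence (a , b) u = δ a u ℕ.+ δ b u

∑-incidence-sift : (a b : Fin n) (g : Fin n → ℕ) →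
  ∑[ u < n ] (incidence (a , b) u ℕ.* g u) ≡ g a ℕ.+ g b
∑-incidence-sift {n} a b g = begin
  ∑[ u < n ] (incidence (a , b) u ℕ.* g u)
    ≡⟨ sum-cong-≗ (λ u → ℕ.*-distribʳ-+ (g u) (δ a u) (δ b u)) ⟩
  ∑[ u < n ] (δ a u ℕ.* g u ℕ.+ δ b u ℕ.* g u)
    ≡⟨ ∑-distrib-+ (λ u → δ a u ℕ.* g u) (λ u → δ b u ℕ.* g u) ⟩
  ∑[ u < n ] (δ a u ℕ.* g u) ℕ.+ ∑[ u < n ] (δ b u ℕ.* g u)
    ≡⟨ cong₂ ℕ._+_ (∑-δ-sift a g) (∑-δ-sift b g) ⟩
  g a ℕ.+ g b ∎
  where open ≡-Reasoning

∑-incidence : (a b : Fin n) → ∑[ u < n ] incidence (a , b) u ≡ 2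
∑-incidence a b =
  trans (sum-cong-≗ (λ u → sym (ℕ.*-identityʳ (incidence (a , b) u)))) (∑-incidence-sift a b (λ _ → 1))

incidence²≡incidence : (a b u : Fin n) → a ≢ b →
  incidence (a , b) u ℕ.* incidence (a , b) u ≡ incidence (a , b) u
incidence²≡incidence a b u a≢b with a Fin.≟ u | b Fin.≟ u
... | yes refl | yes refl = ⊥-elim (a≢b refl)
... | yes _    | no _     = refl
... | no _     | yes _    = refl
... | no _     | no _     = refl

degree-∷ : (a b : Fin n) (E : List (Edge n)) (u : Fin n) → a ≢ b →
  degree ((a , b) ∷ E) u ≡ incidence (a , b) u ℕ.+ degree E u
degree-∷ a b E u a≢b with a Fin.≟ u | b Fin.≟ u
... | yes refl | yes refl = ⊥-elim (a≢b refl)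
... | yes _    | no _     = refl
... | no _     | yes _    = refl
... | no _     | no _     = refl

Oriented : Edge n → Set
Oriented e = proj₁ e Fin.< proj₂ e

handshake : (E : List (Edge n)) → All Oriented E → ∑[ u < n ] degree E u ≡ 2 ℕ.* length E
handshake {n} [] [] = sum-replicate-zero n
handshake {n} ((a , b) ∷ E) (a<b ∷ oriented) = begin
  ∑[ u < n ] degree ((a , b) ∷ E) u
    ≡⟨ sum-cong-≗ (λ u → degree-∷ a b E u (<⇒≢ a<b)) ⟩
  ∑[ u < n ] (incidence (a , b) u ℕ.+ degree E u)
    ≡⟨ ∑-distrib-+ (incidence (a , b)) (degree E) ⟩
  ∑[ u < n ] incidence (a , b) u ℕ.+ ∑[ u < n ] degree E u
    ≡⟨ cong₂ ℕ._+_ (∑-incidence a b) (handshake E oriented) ⟩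
  2 ℕ.+ 2 ℕ.* length E
    ≡⟨ ℕ.*-distribˡ-+ 2 1 (length E) ⟨
  2 ℕ.* length ((a , b) ∷ E) ∎
  where open ≡-Reasoning

∑degree² : List (Edge n) → ℕ
∑degree² {n} E = ∑[ u < n ] (degree E u ℕ.* degree E u)

[i+d]²≡d²+2id+i : ∀ i d → i ℕ.* i ≡ i →
  (i ℕ.+ d) ℕ.* (i ℕ.+ d) ≡ d ℕ.* d ℕ.+ 2 ℕ.* (i ℕ.* d) ℕ.+ i
[i+d]²≡d²+2id+i i d i²≡i = begin
  (i ℕ.+ d) ℕ.* (i ℕ.+ d)                       ≡⟨ expand i d ⟩
  d ℕ.* d ℕ.+ 2 ℕ.* (i ℕ.* d) ℕ.+ i ℕ.* i      ≡⟨ cong (d ℕ.* d ℕ.+ 2 ℕ.* (i ℕ.* d) ℕ.+_) i²≡i ⟩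
  d ℕ.* d ℕ.+ 2 ℕ.* (i ℕ.* d) ℕ.+ i            ∎
  where
  open ≡-Reasoning
  expand : ∀ i d → (i ℕ.+ d) ℕ.* (i ℕ.+ d) ≡ d ℕ.* d ℕ.+ 2 ℕ.* (i ℕ.* d) ℕ.+ i ℕ.* i
  expand = solve-∀

∑degree²-∷ : (a b : Fin n) (E : List (Edge n)) → a ≢ b →
  ∑degree² ((a , b) ∷ E) ≡ ∑degree² E ℕ.+ 2 ℕ.* (degree E a ℕ.+ degree E b) ℕ.+ 2
∑degree²-∷ {n} a b E a≢b = begin
  ∑degree² ((a , b) ∷ E)
    ≡⟨ sum-cong-≗ (λ u → trans (cong (λ x → x ℕ.* x) (degree-∷ a b E u a≢b))
                                (expand u)) ⟩
  ∑[ u < n ] (d u ℕ.* d u ℕ.+ 2 ℕ.* (i u ℕ.* d u) ℕ.+ i u)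
    ≡⟨ ∑-distrib-+ (λ u → d u ℕ.* d u ℕ.+ 2 ℕ.* (i u ℕ.* d u)) i ⟩
  ∑[ u < n ] (d u ℕ.* d u ℕ.+ 2 ℕ.* (i u ℕ.* d u)) ℕ.+ ∑[ u < n ] i u
    ≡⟨ cong₂ ℕ._+_ (∑-distrib-+ (λ u → d u ℕ.* d u) (λ u → 2 ℕ.* (i u ℕ.* d u))) (∑-incidence a b) ⟩
  ∑degree² E ℕ.+ ∑[ u < n ] (2 ℕ.* (i u ℕ.* d u)) ℕ.+ 2
    ≡⟨ cong (λ x → ∑degree² E ℕ.+ x ℕ.+ 2) (*-distribˡ-sum 2 (λ u → i u ℕ.* d u)) ⟨
  ∑degree² E ℕ.+ 2 ℕ.* ∑[ u < n ] (i u ℕ.* d u) ℕ.+ 2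
    ≡⟨ cong (λ x → ∑degree² E ℕ.+ 2 ℕ.* x ℕ.+ 2) (∑-incidence-sift a b d) ⟩
  ∑degree² E ℕ.+ 2 ℕ.* (d a ℕ.+ d b) ℕ.+ 2 ∎
  where
  open ≡-Reasoning
  d = degree E
  i = incidence (a , b)
  expand : ∀ u → (i u ℕ.+ d u) ℕ.* (i u ℕ.+ d u) ≡ d u ℕ.* d u ℕ.+ 2 ℕ.* (i u ℕ.* d u) ℕ.+ i u
  expand u = [i+d]²≡d²+2id+i (i u) (d u) (incidence²≡incidence a b u a≢b)

incidence-endpoints-≤1 : (a b c e : Fin n) → a Fin.< b → c Fin.< e → (a , b) ≢ (c , e) →
  incidence (c , e) a ℕ.+ incidence (c , e) b ℕ.≤ 1
incidence-endpoints-≤1 a b c e a<b c<e ab≢ce with c Fin.≟ a | e Fin.≟ a | c Fin.≟ b | e Fin.≟ b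
... | yes refl | yes refl | _        | _        = ⊥-elim (Fin.<-irrefl refl c<e)
... | _        | _        | yes refl | yes refl = ⊥-elim (Fin.<-irrefl refl c<e)
... | yes refl | _        | yes refl | _        = ⊥-elim (Fin.<-irrefl refl a<b)
... | _        | yes refl | _        | yes refl = ⊥-elim (Fin.<-irrefl refl a<b)
... | yes refl | _        | _        | yes refl = ⊥-elim (ab≢ce refl)
... | _        | yes refl | yes refl | _        = ⊥-elim (Fin.<-asym a<b c<e)
... | yes _    | no _     | no _     | no _     = ℕ.≤-refl
... | no _     | yes _    | no _     | no _     = ℕ.≤-refl
... | no _     | no _     | yes _    | no _     = ℕ.≤-refl
... | no _     | no _     | no _     | yes _    = ℕ.≤-refl
... | no _     | no _     | no _     | no _     = z≤n

degree-endpoints-≤ : (a b : Fin n) (E : List (Edge n)) → a Fin.< b → All Oriented E →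
  All ((a , b) ≢_) E → degree E a ℕ.+ degree E b ℕ.≤ length E
degree-endpoints-≤ a b [] a<b [] [] = z≤n
degree-endpoints-≤ a b ((c , e) ∷ E) a<b (c<e ∷ oriented) (ab≢ce ∷ fresh) = begin
  degree ((c , e) ∷ E) a ℕ.+ degree ((c , e) ∷ E) b
    ≡⟨ cong₂ ℕ._+_ (degree-∷ c e E a (<⇒≢ c<e)) (degree-∷ c e E b (<⇒≢ c<e)) ⟩
  (incidence (c , e) a ℕ.+ degree E a) ℕ.+ (incidence (c , e) b ℕ.+ degree E b)
    ≡⟨ +-interchange (incidence (c , e) a) (degree E a) (incidence (c , e) b) (degree E b) ⟩
  (incidence (c , e) a ℕ.+ incidence (c , e) b) ℕ.+ (degree E a ℕ.+ degree E b)
    ≤⟨ ℕ.+-mono-≤ (incidence-endpoints-≤1 a b c e a<b c<e ab≢ce)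
                  (degree-endpoints-≤ a b E a<b oriented fresh) ⟩
  1 ℕ.+ length E ∎
  where open ℕ.≤-Reasoning

∑degree²-≤ : (E : List (Edge n)) → All Oriented E → Unique E →
  ∑degree² E ℕ.≤ length E ℕ.* suc (length E)
∑degree²-≤ {n} [] [] [] = ℕ.≤-reflexive (sum-replicate-zero n)
∑degree²-≤ ((a , b) ∷ E) (a<b ∷ oriented) (fresh ∷ unique) = begin
  ∑degree² ((a , b) ∷ E)
    ≡⟨ ∑degree²-∷ a b E (<⇒≢ a<b) ⟩
  ∑degree² E ℕ.+ 2 ℕ.* (degree E a ℕ.+ degree E b) ℕ.+ 2
    ≤⟨ ℕ.+-monoˡ-≤ 2 (ℕ.+-mono-≤ (∑degree²-≤ E oriented unique)
                                  (ℕ.*-monoʳ-≤ 2 (degree-endpoints-≤ a b E a<b oriented fresh))) ⟩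
  m ℕ.* suc m ℕ.+ 2 ℕ.* m ℕ.+ 2
    ≡⟨ m[1+m]+2m+2≡[1+m][2+m] m ⟩
  suc m ℕ.* suc (suc m) ∎
  where
  open ℕ.≤-Reasoning
  m = length E
  m[1+m]+2m+2≡[1+m][2+m] : ∀ m → m ℕ.* suc m ℕ.+ 2 ℕ.* m ℕ.+ 2 ≡ suc m ℕ.* suc (suc m)
  m[1+m]+2m+2≡[1+m][2+m] = solve-∀

∑degree²-≥ : (E : List (Edge n)) → All Oriented E → 2 ℕ.* length E ℕ.≤ ∑degree² E
∑degree²-≥ {n} E oriented = begin
  2 ℕ.* length E            ≡⟨ handshake E oriented ⟨
  ∑[ u < n ] degree E u     ≤⟨ ∑-mono-≤ (λ u → m≤m*m (degree E u)) ⟩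
  ∑degree² E                ∎
  where
  open ℕ.≤-Reasoning
  m≤m*m : ∀ m → m ℕ.≤ m ℕ.* m
  m≤m*m zero = z≤n
  m≤m*m (suc m) = ℕ.m≤m*n (suc m) (suc m)

ι : ℕ → ℚ
ι k = + k / 1

-- Identities between the normalised fractions + k / m are transported from ℚᵘ, where they hold without gcds.
toℚᵘ-/ : ∀ i m .{{_ : NonZero m}} → toℚᵘ (i / m) ℚᵘ.≃ (i ℚᵘ./ m)
toℚᵘ-/ i (suc k) = ℚ.toℚᵘ-fromℚᵘ (ℚᵘ.mkℚᵘ i k)

ι-+ : ∀ a b → ι (a ℕ.+ b) ≡ ι a + ι b
ι-+ a b = ℚ.toℚᵘ-injective (begin
  toℚᵘ (ι (a ℕ.+ b))                  ≈⟨ toℚᵘ-/ (+ (a ℕ.+ b)) 1 ⟩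
  + (a ℕ.+ b) ℚᵘ./ 1                   ≈⟨ ℚᵘ.≃-reflexive (cong (ℚᵘ._/ 1) +[a+b]≡a*1+b*1) ⟩
  (+ a ℚᵘ./ 1) ℚᵘ.+ (+ b ℚᵘ./ 1)        ≈⟨ ℚᵘ.+-cong (toℚᵘ-/ (+ a) 1) (toℚᵘ-/ (+ b) 1) ⟨
  toℚᵘ (ι a) ℚᵘ.+ toℚᵘ (ι b)            ≈⟨ ℚ.toℚᵘ-homo-+ (ι a) (ι b) ⟨
  toℚᵘ (ι a + ι b)                      ∎)
  where
  open ℚᵘ.≃-Reasoning
  +[a+b]≡a*1+b*1 : + (a ℕ.+ b) ≡ + a ℤ.* + 1 ℤ.+ + b ℤ.* + 1
  +[a+b]≡a*1+b*1 = trans (ℤ.pos-+ a b) (sym (cong₂ ℤ._+_ (ℤ.*-identityʳ (+ a)) (ℤ.*-identityʳ (+ b))))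

ι-* : ∀ a b → ι (a ℕ.* b) ≡ ι a * ι b
ι-* a b = ℚ.toℚᵘ-injective (begin
  toℚᵘ (ι (a ℕ.* b))                  ≈⟨ toℚᵘ-/ (+ (a ℕ.* b)) 1 ⟩
  + (a ℕ.* b) ℚᵘ./ 1                   ≈⟨ ℚᵘ.≃-reflexive (cong (ℚᵘ._/ 1) (ℤ.pos-* a b)) ⟩
  (+ a ℚᵘ./ 1) ℚᵘ.* (+ b ℚᵘ./ 1)        ≈⟨ ℚᵘ.*-cong (toℚᵘ-/ (+ a) 1) (toℚᵘ-/ (+ b) 1) ⟨
  toℚᵘ (ι a) ℚᵘ.* toℚᵘ (ι b)            ≈⟨ ℚ.toℚᵘ-homo-* (ι a) (ι b) ⟨
  toℚᵘ (ι a * ι b)                      ∎)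
  where open ℚᵘ.≃-Reasoning

ι-mono-≤ : ∀ {a b} → a ℕ.≤ b → ι a ≤ ι b
ι-mono-≤ {a} {b} a≤b = ℚ.toℚᵘ-cancel-≤ (begin
  toℚᵘ (ι a)      ≃⟨ toℚᵘ-/ (+ a) 1 ⟩
  + a ℚᵘ./ 1      ≤⟨ ℚᵘ.*≤* (ℤ.*-monoʳ-≤-nonNeg (+ 1) (ℤ.+≤+ a≤b)) ⟩
  + b ℚᵘ./ 1      ≃⟨ toℚᵘ-/ (+ b) 1 ⟨
  toℚᵘ (ι b)      ∎)
  where open ℚᵘ.≤-Reasoning

/≡ι*1/ : ∀ x m .{{_ : NonZero m}} → + x / m ≡ ι x * (+ 1 / m)
/≡ι*1/ x m@(suc _) = ℚ.toℚᵘ-injective (begin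
  toℚᵘ (+ x / m)                       ≈⟨ toℚᵘ-/ (+ x) m ⟩
  + x ℚᵘ./ m                           ≡⟨ ℚᵘ./-cong (ℤ.*-identityʳ (+ x)) (ℕ.*-identityˡ m) ⟨
  (+ x ℚᵘ./ 1) ℚᵘ.* (+ 1 ℚᵘ./ m)       ≈⟨ ℚᵘ.*-cong (toℚᵘ-/ (+ x) 1) (toℚᵘ-/ (+ 1) m) ⟨
  toℚᵘ (ι x) ℚᵘ.* toℚᵘ (+ 1 / m)       ≈⟨ ℚ.toℚᵘ-homo-* (ι x) (+ 1 / m) ⟨
  toℚᵘ (ι x * (+ 1 / m))               ∎)
  where open ℚᵘ.≃-Reasoning

m/m≡1 : ∀ m .{{_ : NonZero m}} → + m / m ≡ 1ℚ
m/m≡1 m@(suc _) = ℚ.toℚᵘ-injective (ℚᵘ.≃-trans (toℚᵘ-/ (+ m) m) (ℚᵘ.*≡* (ℤ.*-comm (+ m) (+ 1))))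

ι*1/≡1 : ∀ m .{{_ : NonZero m}} → ι m * (+ 1 / m) ≡ 1ℚ
ι*1/≡1 m = trans (sym (/≡ι*1/ m m)) (m/m≡1 m)

foldr-tabulate≡∑ : (f : Fin n → ℚ) → foldr _+_ 0ℚ (tabulate f) ≡ ℚΣ.sum f
foldr-tabulate≡∑ {zero}  f = refl
foldr-tabulate≡∑ {suc n} f = cong (_+_ (f zero)) (foldr-tabulate≡∑ (λ u → f (suc u)))

sumV≡∑ : (f : Fin n → ℚ) → sumV n f ≡ ℚΣ.sum f
sumV≡∑ f = trans (cong (foldr _+_ 0ℚ) (List.map-tabulate (λ u → u) f)) (foldr-tabulate≡∑ f)

∑-ι-affine : (f g : Fin n → ℕ) (r : ℚ) →
  ℚΣ.sum (λ u → ι (f u) - ι (g u) * r) ≡ ι (∑[ u < n ] f u) - ι (∑[ u < n ] g u) * r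
∑-ι-affine {zero} f g r = solve 1 (λ r → con 0ℚ := con 0ℚ :- con 0ℚ :* r) refl r
  where open ℚ-Solver
∑-ι-affine {suc n} f g r = begin
  (ι f₀ - ι g₀ * r) + ℚΣ.sum (λ u → ι (f (suc u)) - ι (g (suc u)) * r)
    ≡⟨ cong (_+_ (ι f₀ - ι g₀ * r)) (∑-ι-affine (λ u → f (suc u)) (λ u → g (suc u)) r) ⟩
  (ι f₀ - ι g₀ * r) + (ι F - ι G * r)
    ≡⟨ solve 5 (λ a b c d r → (a :- b :* r) :+ (c :- d :* r) := (a :+ c) :- (b :+ d) :* r)
             refl (ι f₀) (ι g₀) (ι F) (ι G) r ⟩
  (ι f₀ + ι F) - (ι g₀ + ι G) * r
    ≡⟨ cong₂ (λ x y → x - y * r) (ι-+ f₀ F) (ι-+ g₀ G) ⟨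
  ι (f₀ ℕ.+ F) - ι (g₀ ℕ.+ G) * r ∎
  where
  open ≡-Reasoning
  open ℚ-Solver
  f₀ = f zero
  g₀ = g zero
  F = ∑[ u < n ] f (suc u)
  G = ∑[ u < n ] g (suc u)

d[1-d/m]≡d-d²/m : ∀ d m .{{_ : NonZero m}} → ι d * (1ℚ - + d / m) ≡ ι d - ι (d ℕ.* d) * (+ 1 / m)
d[1-d/m]≡d-d²/m d m = begin
  ι d * (1ℚ - + d / m)           ≡⟨ cong (λ x → ι d * (1ℚ - x)) (/≡ι*1/ d m) ⟩
  ι d * (1ℚ - ι d * r)           ≡⟨ solve 2 (λ d r → d :* (con 1ℚ :- d :* r) := d :- (d :* d) :* r) refl (ι d) r ⟩
  ι d - (ι d * ι d) * r          ≡⟨ cong (λ x → ι d - x * r) (ι-* d d) ⟨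
  ι d - ι (d ℕ.* d) * r          ∎
  where
  open ≡-Reasoning
  open ℚ-Solver
  r = + 1 / m

Cost≡2m-∑d²/m : (E : List (Edge n)) (ne : length E > 0) → All Oriented E →
  Cost E ne ≡ ι (2 ℕ.* length E) - ι (∑degree² E) * _/_ (+ 1) (length E) {{>-nonZero ne}}
Cost≡2m-∑d²/m {n} E ne oriented = begin
  Cost E ne
    ≡⟨ sumV≡∑ {n} (λ u → ι (d u) * (1ℚ - + d u / m)) ⟩
  ℚΣ.sum (λ u → ι (d u) * (1ℚ - + d u / m))
    ≡⟨ ℚΣ.sum-cong-≗ (λ u → d[1-d/m]≡d-d²/m (d u) m) ⟩
  ℚΣ.sum (λ u → ι (d u) - ι (d u ℕ.* d u) * (+ 1 / m))
    ≡⟨ ∑-ι-affine d (λ u → d u ℕ.* d u) (+ 1 / m) ⟩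
  ι (∑[ u < n ] d u) - ι (∑degree² E) * (+ 1 / m)
    ≡⟨ cong (λ x → ι x - ι (∑degree² E) * (+ 1 / m)) (handshake E oriented) ⟩
  ι (2 ℕ.* m) - ι (∑degree² E) * (+ 1 / m) ∎
  where
  open ≡-Reasoning
  m = length E
  d = degree E
  instance
    m≢0 : NonZero m
    m≢0 = >-nonZero ne

2m-S/m-bounds : ∀ m S .{{_ : NonZero m}} → m ℕ.≤ S → S ℕ.≤ m ℕ.* suc m →
  (ι m - 1ℚ ≤ ι (2 ℕ.* m) - ι S * (+ 1 / m)) × (ι (2 ℕ.* m) - ι S * (+ 1 / m) ≤ ι (2 ℕ.* m) - 1ℚ)
2m-S/m-bounds m S m≤S S≤m[1+m] = lower , upper
  where
  open ℚ.≤-Reasoning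
  r = + 1 / m
  instance
    r≥0 : NonNegative r
    r≥0 = ℚ.normalize-nonNeg 1 m

  1≤S/m : 1ℚ ≤ ι S * r
  1≤S/m = begin
    1ℚ      ≡⟨ ι*1/≡1 m ⟨
    ι m * r ≤⟨ ℚ.*-monoʳ-≤-nonNeg r (ι-mono-≤ m≤S) ⟩
    ι S * r ∎

  S/m≤1+m : ι S * r ≤ ι (suc m)
  S/m≤1+m = begin
    ι S * r                  ≤⟨ ℚ.*-monoʳ-≤-nonNeg r (ι-mono-≤ S≤m[1+m]) ⟩
    ι (m ℕ.* suc m) * r      ≡⟨ cong (_* r) (trans (ι-* m (suc m)) (ℚ.*-comm (ι m) (ι (suc m)))) ⟩
    ι (suc m) * ι m * r      ≡⟨ ℚ.*-assoc (ι (suc m)) (ι m) r ⟩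
    ι (suc m) * (ι m * r)    ≡⟨ cong (ι (suc m) *_) (ι*1/≡1 m) ⟩
    ι (suc m) * 1ℚ           ≡⟨ ℚ.*-identityʳ (ι (suc m)) ⟩
    ι (suc m)                ∎

  m-1≡2m-[1+m] : ι m - 1ℚ ≡ ι (2 ℕ.* m) - ι (suc m)
  m-1≡2m-[1+m] = begin-equality
    ι m - 1ℚ                   ≡⟨ solve 1 (λ x → x :- con 1ℚ := (x :+ x) :- (con 1ℚ :+ x)) refl (ι m) ⟩
    (ι m + ι m) - (1ℚ + ι m)   ≡⟨ cong₂ _-_ ι[2m]≡m+m (ι-+ 1 m) ⟨
    ι (2 ℕ.* m) - ι (suc m)    ∎
    where
    open ℚ-Solver
    ι[2m]≡m+m : ι (2 ℕ.* m) ≡ ι m + ι m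
    ι[2m]≡m+m = trans (cong (λ x → ι (m ℕ.+ x)) (ℕ.*-identityˡ m)) (ι-+ m m)

  lower : ι m - 1ℚ ≤ ι (2 ℕ.* m) - ι S * r
  lower = begin
    ι m - 1ℚ                  ≡⟨ m-1≡2m-[1+m] ⟩
    ι (2 ℕ.* m) - ι (suc m)   ≤⟨ ℚ.+-monoʳ-≤ (ι (2 ℕ.* m)) (ℚ.neg-antimono-≤ S/m≤1+m) ⟩
    ι (2 ℕ.* m) - ι S * r     ∎

  upper : ι (2 ℕ.* m) - ι S * r ≤ ι (2 ℕ.* m) - 1ℚ
  upper = ℚ.+-monoʳ-≤ (ι (2 ℕ.* m)) (ℚ.neg-antimono-≤ 1≤S/m)

proposition1 : (n : ℕ) (E : List (Edge n)) → IsSimpleEdgeSet E → (ne : length E > 0) →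
    ((+ length E / 1) - 1ℚ ≤ Cost E ne) × (Cost E ne ≤ (+ (2 *ℕ length E) / 1) - 1ℚ)
proposition1 n E (oriented , unique) ne =
  subst (λ cost → (ι m - 1ℚ ≤ cost) × (cost ≤ ι (2 ℕ.* m) - 1ℚ))
        (sym (Cost≡2m-∑d²/m E ne orientedᴬ))
        (2m-S/m-bounds m (∑degree² E) m≤∑d² (∑degree²-≤ E orientedᴬ unique))
  where
  m = length E
  instance
    m≢0 : NonZero m
    m≢0 = >-nonZero ne
  orientedᴬ : All Oriented E
  orientedᴬ = All.tabulate oriented
  m≤∑d² : m ℕ.≤ ∑degree² E
  m≤∑d² = ℕ.≤-trans (ℕ.m≤n*m m 2) (∑degree²-≥ E orientedᴬ)
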